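{- Let $\tau$ be a relational vocabulary containing $<,+,\times$, let $\mathbf A\in\mathrm{ARITHM}[\tau]$ and $m\in\mathbb N$ with $|A|<m$. Then there is a quantifier-free first-order sentence $\varphi_{\mathbf A_{C(m)}}$ of vocabulary $\tau\cup C(m)$ such that for all $\mathbf B\in\mathrm{ARITHM}[\tau]$: $\mathbf B_{C(m)}\models\varphi_{\mathbf A_{C(m)}}$ if and only if $\mathbf A\cong\mathbf B$.
   Context: For $n\in\mathbb N$ let $[n]:=\{0,1,\dots,n-1\}$ with natural order and ternary relations $+^{[n]}=\{(a,b,c)\in[n]^3:c=a+b\}$, $\times^{[n]}=\{(a,b,c)\in[n]^3:c=a\cdot b\}$. A finite $\tau$-structure $\mathbf A$ ($<$ binary, $+,\times$ ternary in $\tau$) has built-in addition and multiplication if its $\{<,+,\times\}$-reduct is isomorphic to $([n],<^{[n]},+^{[n]},\times^{[n]})$, $n=|A|$; $\mathrm{ARITHM}[\tau]$ is the class of these. $C(m)=\{\overline\ell:\ell<m\}$ is a set of new constants and $\mathbf A_{C(m)}$ is the expansion of $\mathbf A$ interpreting $\overline\ell$ as the element corresponding to $\ell$ if $\ell<|A|$, and to $|A|-1$ otherwise. -}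

module Defs where

open import Data.Nat using (ℕ; zero; suc; _+_; _*_; _<_; _<?_)
open import Data.Fin using (Fin; toℕ; fromℕ; fromℕ<)
open import Data.Vec using (Vec; []; _∷_; map)
open import Data.Bool using (Bool; true)
open import Relation.Binary.PropositionalEquality using (_≡_)
open import Relation.Nullary using (¬_; yes; no)
open import Data.Product using (_×_)
open import Data.Sum using (_⊎_)
open import Function.Bundles using (_↔_; _⇔_; Inverse)

record Vocabulary : Set where
  field
    extra : ℕ
    extraArity : Fin extra → ℕ
open Vocabulary public

data Sym (τ : Vocabulary) : Set where
  lt plus times : Sym τ
  other : Fin (extra τ) → Sym τ

arity : {τ : Vocabulary} → Sym τ → ℕ
arity lt = 2
arity plus = 3
arity times = 3
arity {τ} (other i) = extraArity τ i

-- A finite τ-structure with (nonempty) universe Fin (suc n), i.e. |A| = suc n.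
-- Relations are given by their characteristic (Boolean) functions.
record Structure (τ : Vocabulary) : Set where
  field
    n : ℕ
    rel : (R : Sym τ) → Vec (Fin (suc n)) (arity R) → Bool
open Structure public

Univ : {τ : Vocabulary} → Structure τ → Set
Univ A = Fin (suc (n A))

card : {τ : Vocabulary} → Structure τ → ℕ
card A = suc (n A)

-- A has built-in addition and multiplication: a bijection between the
-- universe and [N] = {0,…,N-1} (N = |A|) which is an isomorphism of the
-- {<,+,×}-reduct of A onto ([N], <, +, ×).
record Arithm {τ : Vocabulary} (A : Structure τ) : Set where
  field
    iso : Univ A ↔ Fin (card A)
  private
    f : Univ A → ℕ
    f a = toℕ (Inverse.to iso a)
  field
    lt-iso    : ∀ a b → (rel A lt (a ∷ b ∷ []) ≡ true) ⇔ (f a < f b)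
    plus-iso  : ∀ a b c → (rel A plus (a ∷ b ∷ c ∷ [])) ≡ true ⇔ (f c ≡ f a + f b)
    times-iso : ∀ a b c → (rel A times (a ∷ b ∷ c ∷ [])) ≡ true ⇔ (f c ≡ f a * f b)
open Arithm public

record _≅_ {τ : Vocabulary} (A B : Structure τ) : Set where
  field
    bij : Univ A ↔ Univ B
    preserves : ∀ (R : Sym τ) (v : Vec (Univ A) (arity R)) →
                rel A R v ≡ rel B R (map (Inverse.to bij) v)

clamp : (k : ℕ) → ℕ → Fin (suc k)
clamp k ℓ with ℓ <? suc k
... | yes p = fromℕ< p
... | no _  = fromℕ k

-- Interpretation of the constant ℓ̄ ∈ C(m) in A_{C(m)}:
-- the element of A corresponding (under the isomorphism with [N]) to
-- ℓ if ℓ < |A|, and to |A| - 1 otherwise.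
constInterp : {τ : Vocabulary} (A : Structure τ) → Arithm A → {m : ℕ} → Fin m → Univ A
constInterp A h ℓ = Inverse.from (iso h) (clamp (n A) (toℕ ℓ))

-- Quantifier-free first-order sentences of vocabulary τ ∪ C(m).
-- Since there are no function symbols and no variables, the only terms are
-- the constants ℓ̄ (ℓ ∈ Fin m).
data QFSentence (τ : Vocabulary) (m : ℕ) : Set where
  atom  : (R : Sym τ) → Vec (Fin m) (arity R) → QFSentence τ m
  eq    : Fin m → Fin m → QFSentence τ m
  ¬'    : QFSentence τ m → QFSentence τ m
  _∧'_  : QFSentence τ m → QFSentence τ m → QFSentence τ m
  _∨'_  : QFSentence τ m → QFSentence τ m → QFSentence τ m

Sat : {τ : Vocabulary} (A : Structure τ) → Arithm A → {m : ℕ} → QFSentence τ m → Set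
Sat A h (atom R cs) = rel A R (map (constInterp A h) cs) ≡ true
Sat A h (eq c d)   = constInterp A h c ≡ constInterp A h d
Sat A h (¬' φ)     = ¬ Sat A h φ
Sat A h (φ ∧' ψ)   = Sat A h φ × Sat A h ψ
Sat A h (φ ∨' ψ)   = Sat A h φ ⊎ Sat A h ψ

-- An arithmetic structure is rigid: an isomorphism between two of them preserves the
-- order, so as a map [N] → [N'] it is strictly monotone both ways and hence sends the
-- element of value i to the element of value i. Thus A ≅ B holds exactly when |A| = |B|
-- and the canonical value-preserving bijection respects every relation. As |A| < m, each
-- element of A is named by the constant of its value, and the sentence is the atomic
-- diagram of A in these names together with a size condition: in B the constant ℓ
-- denotes min(ℓ, |B| - 1), so the constants ℓ + 1 and ℓ coincide iff |B| ≤ ℓ + 1, and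
-- comparing the constants |A|, |A| - 1, |A| - 2 forces |B| = |A|.
module Submission where

open import Defs
open import Data.Bool using (Bool; true; false)
open import Data.Bool.Properties using (¬-not; not-¬)
open import Data.Fin as Fin using (Fin; toℕ; inject₁; cast)
open import Data.Fin.Permutation using (↔⇒≡)
open import Data.Fin.Properties
  using (toℕ-injective; toℕ-inject₁; toℕ-cast; toℕ-fromℕ<; toℕ-fromℕ; toℕ≤pred[n])
open import Data.Nat using (ℕ; zero; suc; _≤_; _<_; _⊓_; z≤n; s≤s)
open import Data.Nat.Properties
open import Data.Product using (Σ; _,_)
open import Data.Vec using (Vec; []; _∷_; map)
open import Data.Vec.Properties using (map-∘; map-cong; map-id)
open import Function using (id; _∘_)
open import Function.Bundles using (_⇔_; mk⇔; Equivalence; _↔_; mk↔ₛ′; Inverse; Injection)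
import Function.Properties.Equivalence as ⇔
open import Function.Properties.Inverse using (↔-sym; ↔⇒↣)
open import Relation.Binary.Core using (_Preserves_⟶_)
open import Relation.Binary.PropositionalEquality
open import Relation.Nullary using (contradiction; yes; no)

open Equivalence using (to; from)
open _≅_

toℕ-clamp : ∀ k ℓ → toℕ (clamp k ℓ) ≡ ℓ ⊓ k
toℕ-clamp k ℓ with ℓ <? suc k
... | yes ℓ<1+k = trans (toℕ-fromℕ< ℓ<1+k) (sym (m≤n⇒m⊓n≡m (≤-pred ℓ<1+k)))
... | no ℓ≮1+k  = trans (toℕ-fromℕ k) (sym (m≥n⇒m⊓n≡n (<⇒≤ (≮⇒≥ ℓ≮1+k))))

toℕ-clamp-≤ : ∀ {k ℓ} → ℓ ≤ k → toℕ (clamp k ℓ) ≡ ℓ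
toℕ-clamp-≤ {k} {ℓ} ℓ≤k = trans (toℕ-clamp k ℓ) (m≤n⇒m⊓n≡m ℓ≤k)

suc-⊓≡⊓⇔≤ : ∀ q b → (suc q ⊓ b ≡ q ⊓ b) ⇔ (b ≤ q)
suc-⊓≡⊓⇔≤ q b = mk⇔ ⊓-equal⇒≤ ≤⇒⊓-equal
  where
  ≤⇒⊓-equal : b ≤ q → suc q ⊓ b ≡ q ⊓ b
  ≤⇒⊓-equal b≤q = trans (m≥n⇒m⊓n≡n (m≤n⇒m≤1+n b≤q)) (sym (m≥n⇒m⊓n≡n b≤q))

  ⊓-equal⇒≤ : suc q ⊓ b ≡ q ⊓ b → b ≤ q
  ⊓-equal⇒≤ e with b ≤? q
  ... | yes b≤q = b≤q
  ... | no b≰q  = contradiction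
    (trans (sym (m≤n⇒m⊓n≡m (≰⇒> b≰q))) (trans e (m≤n⇒m⊓n≡m (<⇒≤ (≰⇒> b≰q)))))
    (1+n≢n {q})

strictMono⇒inflationary : ∀ {N M} (f : Fin N → Fin M) →
  f Preserves Fin._<_ ⟶ Fin._<_ → ∀ i → toℕ i ≤ toℕ (f i)
strictMono⇒inflationary f mono Fin.zero    = z≤n
strictMono⇒inflationary f mono (Fin.suc i) =
  ≤-<-trans (strictMono⇒inflationary (f ∘ inject₁) (mono ∘ inject₁-mono) i)
            (mono (s≤s (≤-reflexive (toℕ-inject₁ i))))
  where
  inject₁-mono : ∀ {N} {i j : Fin N} → i Fin.< j → inject₁ i Fin.< inject₁ j
  inject₁-mono {i = i} {j} = subst₂ _<_ (sym (toℕ-inject₁ i)) (sym (toℕ-inject₁ j))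

module _ {τ : Vocabulary} {A : Structure τ} (hA : Arithm A) where

  val : Univ A → ℕ
  val a = toℕ (Inverse.to (iso hA) a)

  val-from : ∀ i → val (Inverse.from (iso hA) i) ≡ toℕ i
  val-from i = cong toℕ (Inverse.strictlyInverseˡ (iso hA) i)

  val-injective : ∀ {a b} → val a ≡ val b → a ≡ b
  val-injective = Injection.injective (↔⇒↣ (iso hA)) ∘ toℕ-injective

  val≤n : ∀ a → val a ≤ n A
  val≤n a = toℕ≤pred[n] (Inverse.to (iso hA) a)

  val-constInterp : ∀ {m} (c : Fin m) → val (constInterp A hA c) ≡ toℕ c ⊓ n A
  val-constInterp c = trans (val-from _) (toℕ-clamp (n A) (toℕ c))

  Sat-eq : ∀ {m} (c d : Fin m) → Sat A hA (eq c d) ⇔ (toℕ c ⊓ n A ≡ toℕ d ⊓ n A)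
  Sat-eq c d = mk⇔
    (λ e → trans (sym (val-constInterp c)) (trans (cong val e) (val-constInterp d)))
    (λ e → val-injective (trans (val-constInterp c) (trans e (sym (val-constInterp d)))))

literal : ∀ {τ m} → Bool → QFSentence τ m → QFSentence τ m
literal true  φ = φ
literal false φ = ¬' φ

⊤' : ∀ {τ m} → QFSentence τ (suc m)
⊤' = eq Fin.zero Fin.zero

⋀ : ∀ {τ m} (k : ℕ) → (Fin k → QFSentence τ (suc m)) → QFSentence τ (suc m)
⋀ zero    φ = ⊤'
⋀ (suc k) φ = φ Fin.zero ∧' ⋀ k (φ ∘ Fin.suc)

⋀Vec : ∀ {τ m} (N a : ℕ) → (Vec (Fin N) a → QFSentence τ (suc m)) → QFSentence τ (suc m)
⋀Vec N zero    φ = φ []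
⋀Vec N (suc a) φ = ⋀ N (λ x → ⋀Vec N a (φ ∘ (x ∷_)))

⋀Sym : ∀ {τ m} → (Sym τ → QFSentence τ (suc m)) → QFSentence τ (suc m)
⋀Sym {τ} φ = φ lt ∧' (φ plus ∧' (φ times ∧' ⋀ (extra τ) (φ ∘ other)))

module _ {τ : Vocabulary} {B : Structure τ} (hB : Arithm B) {m : ℕ} where

  Sat-literal : ∀ (R : Sym τ) (cs : Vec (Fin m) (arity R)) b →
    Sat B hB (literal b (atom R cs)) ⇔ (rel B R (map (constInterp B hB) cs) ≡ b)
  Sat-literal R cs true  = mk⇔ id id
  Sat-literal R cs false = mk⇔ ¬-not not-¬

  Sat-⋀ : ∀ k (φ : Fin k → QFSentence τ (suc m)) →
    Sat B hB (⋀ k φ) ⇔ (∀ i → Sat B hB (φ i))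
  Sat-⋀ zero    φ = mk⇔ (λ _ ()) (λ _ → refl)
  Sat-⋀ (suc k) φ = mk⇔
    (λ { (s , ss) Fin.zero → s ; (s , ss) (Fin.suc i) → to (Sat-⋀ k (φ ∘ Fin.suc)) ss i })
    (λ f → f Fin.zero , from (Sat-⋀ k (φ ∘ Fin.suc)) (f ∘ Fin.suc))

  Sat-⋀Vec : ∀ N a (φ : Vec (Fin N) a → QFSentence τ (suc m)) →
    Sat B hB (⋀Vec N a φ) ⇔ (∀ v → Sat B hB (φ v))
  Sat-⋀Vec N zero    φ = mk⇔ (λ { s [] → s }) (λ f → f [])
  Sat-⋀Vec N (suc a) φ = mk⇔
    (λ { s (x ∷ v) → to (Sat-⋀Vec N a (φ ∘ (x ∷_))) (to (Sat-⋀ N _) s x) v })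
    (λ f → from (Sat-⋀ N _) (λ x → from (Sat-⋀Vec N a (φ ∘ (x ∷_))) (f ∘ (x ∷_))))

  Sat-⋀Sym : ∀ (φ : Sym τ → QFSentence τ (suc m)) →
    Sat B hB (⋀Sym φ) ⇔ (∀ R → Sat B hB (φ R))
  Sat-⋀Sym φ = mk⇔
    (λ { (s , _) lt → s
       ; (_ , s , _) plus → s
       ; (_ , _ , s , _) times → s
       ; (_ , _ , _ , s) (other i) → to (Sat-⋀ (extra τ) (φ ∘ other)) s i })
    (λ f → f lt , f plus , f times , from (Sat-⋀ (extra τ) (φ ∘ other)) (f ∘ other))

RelationPreserving : ∀ {τ} (A B : Structure τ) → (Univ A → Univ B) → Set
RelationPreserving A B f = ∀ R v → rel A R v ≡ rel B R (map f v)

module _ {τ : Vocabulary} {A B : Structure τ} where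

  ≅-sym : A ≅ B → B ≅ A
  ≅-sym g = record { bij = ↔-sym (bij g) ; preserves = preserved }
    where
    open Inverse (bij g) using () renaming (to to f; from to f⁻¹)

    map-f∘f⁻¹ : ∀ {a} (v : Vec (Univ B) a) → map f (map f⁻¹ v) ≡ v
    map-f∘f⁻¹ v = begin
      map f (map f⁻¹ v) ≡⟨ map-∘ f f⁻¹ v ⟨
      map (f ∘ f⁻¹) v   ≡⟨ map-cong (Inverse.strictlyInverseˡ (bij g)) v ⟩
      map id v          ≡⟨ map-id v ⟩
      v                 ∎
      where open ≡-Reasoning

    preserved : RelationPreserving B A f⁻¹
    preserved R v = trans (cong (rel B R) (sym (map-f∘f⁻¹ v))) (sym (preserves g R (map f⁻¹ v)))

  ≅⇒n≡n : A ≅ B → n A ≡ n B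
  ≅⇒n≡n g = suc-injective (↔⇒≡ (bij g))

module _ {τ : Vocabulary} {A B : Structure τ} (hA : Arithm A) (hB : Arithm B) where

  ≅-preserves-< : (g : A ≅ B) → ∀ {a a'} →
    val hA a < val hA a' → val hB (Inverse.to (bij g) a) < val hB (Inverse.to (bij g) a')
  ≅-preserves-< g {a} {a'} a<a' =
    to (lt-iso hB _ _) (trans (sym (preserves g lt (a ∷ a' ∷ []))) (from (lt-iso hA a a') a<a'))

  ≅-val-≤ : (g : A ≅ B) → ∀ a → val hA a ≤ val hB (Inverse.to (bij g) a)
  ≅-val-≤ g a = subst (λ x → val hA a ≤ val hB (Inverse.to (bij g) x))
    (Inverse.strictlyInverseʳ (iso hA) a)
    (strictMono⇒inflationary σ σ-mono (Inverse.to (iso hA) a))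
    where
    σ : Fin (card A) → Fin (card B)
    σ = Inverse.to (iso hB) ∘ Inverse.to (bij g) ∘ Inverse.from (iso hA)

    σ-mono : σ Preserves Fin._<_ ⟶ Fin._<_
    σ-mono {i} {j} = ≅-preserves-< g ∘ subst₂ _<_ (sym (val-from hA i)) (sym (val-from hA j))

  canonical : n A ≡ n B → Univ A → Univ B
  canonical e = Inverse.from (iso hB) ∘ cast (cong suc e) ∘ Inverse.to (iso hA)

  val-canonical : ∀ e a → val hB (canonical e a) ≡ val hA a
  val-canonical e a = trans (val-from hB _) (toℕ-cast _ _)

module _ {τ : Vocabulary} {A B : Structure τ} (hA : Arithm A) (hB : Arithm B) where

  ≅-val : (g : A ≅ B) → ∀ a → val hB (Inverse.to (bij g) a) ≡ val hA a
  ≅-val g a = ≤-antisym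
    (subst (λ x → val hB (Inverse.to (bij g) a) ≤ val hA x)
      (Inverse.strictlyInverseʳ (bij g) a)
      (≅-val-≤ hB hA (≅-sym g) (Inverse.to (bij g) a)))
    (≅-val-≤ hA hB g a)

  canonical↔ : n A ≡ n B → Univ A ↔ Univ B
  canonical↔ e = mk↔ₛ′ (canonical hA hB e) (canonical hB hA (sym e))
    (λ b → val-injective hB (trans (val-canonical hA hB e _) (val-canonical hB hA (sym e) b)))
    (λ a → val-injective hA (trans (val-canonical hB hA (sym e) _) (val-canonical hA hB e a)))

  ≅⇔canonical-preserving : (e : n A ≡ n B) →
    (A ≅ B) ⇔ RelationPreserving A B (canonical hA hB e)
  ≅⇔canonical-preserving e = mk⇔
    (λ g R v → trans (preserves g R v) (cong (rel B R) (map-cong (≅-canonical g) v)))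
    (λ p → record { bij = canonical↔ e ; preserves = p })
    where
    ≅-canonical : (g : A ≅ B) → ∀ a → Inverse.to (bij g) a ≡ canonical hA hB e a
    ≅-canonical g a = val-injective hB (trans (≅-val g a) (sym (val-canonical hA hB e a)))

module _ {τ : Vocabulary} (m : ℕ) where

  atMost : ℕ → QFSentence τ (suc m)
  atMost q = eq (clamp m (suc q)) (clamp m q)

  hasSize : ℕ → QFSentence τ (suc m)
  hasSize zero    = atMost zero
  hasSize (suc q) = atMost (suc q) ∧' ¬' (atMost q)

module _ {τ : Vocabulary} {B : Structure τ} (hB : Arithm B) {m : ℕ} where

  Sat-atMost : ∀ {q} → suc q ≤ m → Sat B hB (atMost m q) ⇔ (n B ≤ q)
  Sat-atMost {q} 1+q≤m = ⇔.trans (Sat-eq hB _ _)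
    (subst₂ (λ x y → (x ⊓ n B ≡ y ⊓ n B) ⇔ (n B ≤ q))
      (sym (toℕ-clamp-≤ 1+q≤m)) (sym (toℕ-clamp-≤ (≤-trans (n≤1+n q) 1+q≤m)))
      (suc-⊓≡⊓⇔≤ q (n B)))

  Sat-hasSize : ∀ {q} → suc q ≤ m → Sat B hB (hasSize m q) ⇔ (n B ≡ q)
  Sat-hasSize {zero}  1≤m   = ⇔.trans (Sat-atMost 1≤m) (mk⇔ n≤0⇒n≡0 ≤-reflexive)
  Sat-hasSize {suc q} 2+q≤m = mk⇔
    (λ (≤1+q , ≰q) → ≤-antisym (to (Sat-atMost 2+q≤m) ≤1+q) (≰⇒> (≰q ∘ from (Sat-atMost 1+q≤m))))
    (λ e → from (Sat-atMost 2+q≤m) (≤-reflexive e)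
         , λ s → 1+n≰n (subst (_≤ q) e (to (Sat-atMost 1+q≤m) s)))
    where
    1+q≤m : suc q ≤ m
    1+q≤m = ≤-trans (n≤1+n (suc q)) 2+q≤m

module _ {τ : Vocabulary} {A : Structure τ} (hA : Arithm A) {m : ℕ} where

  name : Univ A → Fin (suc m)
  name a = clamp m (val hA a)

  diagram-literal : (R : Sym τ) → Vec (Univ A) (arity R) → QFSentence τ (suc m)
  diagram-literal R v = literal (rel A R v) (atom R (map name v))

  diagram : QFSentence τ (suc m)
  diagram = ⋀Sym λ R → ⋀Vec (card A) (arity R) (diagram-literal R)

  module _ {B : Structure τ} (hB : Arithm B) where

    Sat-diagram⇔literals : Sat B hB diagram ⇔ (∀ R v → Sat B hB (diagram-literal R v))
    Sat-diagram⇔literals = mk⇔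
      (λ s R → to (Sat-⋀Vec hB _ _ (diagram-literal R)) (to (Sat-⋀Sym hB relation) s R))
      (λ f → from (Sat-⋀Sym hB relation) λ R → from (Sat-⋀Vec hB _ _ (diagram-literal R)) (f R))
      where
      relation : Sym τ → QFSentence τ (suc m)
      relation R = ⋀Vec (card A) (arity R) (diagram-literal R)

    module _ (nA≤m : n A ≤ m) (e : n A ≡ n B) where

      constInterp-name : ∀ a → constInterp B hB (name a) ≡ canonical hA hB e a
      constInterp-name a = val-injective hB (begin
        val hB (constInterp B hB (name a)) ≡⟨ val-constInterp hB (name a) ⟩
        toℕ (name a) ⊓ n B                 ≡⟨ cong (_⊓ n B) (toℕ-clamp-≤ (≤-trans (val≤n hA a) nA≤m)) ⟩
        val hA a ⊓ n B                     ≡⟨ m≤n⇒m⊓n≡m (subst (val hA a ≤_) e (val≤n hA a)) ⟩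
        val hA a                           ≡⟨ val-canonical hA hB e a ⟨
        val hB (canonical hA hB e a)       ∎)
        where open ≡-Reasoning

      Sat-diagram-literal : ∀ R v →
        Sat B hB (diagram-literal R v) ⇔ (rel B R (map (canonical hA hB e) v) ≡ rel A R v)
      Sat-diagram-literal R v = subst (λ w → Sat B hB (diagram-literal R v) ⇔ (rel B R w ≡ rel A R v))
        (trans (sym (map-∘ _ name v)) (map-cong constInterp-name v))
        (Sat-literal hB R (map name v) (rel A R v))

      Sat-diagram : Sat B hB diagram ⇔ RelationPreserving A B (canonical hA hB e)
      Sat-diagram = mk⇔
        (λ s R v → sym (to (Sat-diagram-literal R v) (to Sat-diagram⇔literals s R v)))
        (λ p → from Sat-diagram⇔literals λ R v → from (Sat-diagram-literal R v) (sym (p R v)))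

lemma2p5 : (τ : Vocabulary) (A : Structure τ) (hA : Arithm A) (m : ℕ) →
           card A < m →
           Σ (QFSentence τ m) (λ φ →
             (B : Structure τ) (hB : Arithm B) → (Sat B hB φ ⇔ (A ≅ B)))
lemma2p5 τ A hA (suc m) (s≤s |A|≤m) = hasSize m (n A) ∧' diagram hA , λ B hB → mk⇔
  (λ (size , diag) → let e = sym (to (Sat-hasSize hB |A|≤m) size) in
    from (≅⇔canonical-preserving hA hB e) (to (Sat-diagram hA hB nA≤m e) diag))
  (λ g → let e = ≅⇒n≡n g in
    from (Sat-hasSize hB |A|≤m) (sym e) ,
    from (Sat-diagram hA hB nA≤m e) (to (≅⇔canonical-preserving hA hB e) g))
  where
  nA≤m : n A ≤ m
  nA≤m = <⇒≤ |A|≤m
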